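{- $\mathrm{Adm}^{\mathrm{reg}}(\rho)\cap X_*(\check T)=\{t^{w\rho}:w\in W\}$.
   Context: $\check G$ is a split reductive group with maximal torus $\check T$ and Weyl group $W$; a system of positive roots is fixed, and $\rho\in X_*(\check T)$ satisfies $\langle\rho,\alpha\rangle=1$ for every simple root $\alpha$. $\widetilde W=X_*(\check T)\rtimes W$, where $t^\lambda w$ acts on $X_*(\check T)\otimes\mathbf R$ by $x\mapsto w(x)+\lambda$; $X_*(\check T)\subset\widetilde W$ via $\lambda\mapsto t^\lambda$. $A_0=\{x:0<\langle x,\alpha\rangle<1\text{ for all positive roots }\alpha\}$ is the dominant base alcove, which determines the Bruhat order on $\widetilde W=W_{\mathrm{aff}}\rtimes\Omega$ ($\Omega$ the stabilizer of $A_0$). $\mathrm{Adm}(\lambda)=\{\tilde w\in\widetilde W:\tilde w\le t^{w\lambda}\text{ for some }w\in W\}$. $\tilde w$ is regular if for no positive root $\alpha$ is $\tilde w(A_0)$ contained in $\{x:0<\langle x,\alpha\rangle<1\}$; $\mathrm{Adm}^{\mathrm{reg}}(\lambda)$ is the set of regular elements of $\mathrm{Adm}(\lambda)$. -}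

module Defs where

open import Data.Nat as ℕ using (ℕ; zero; suc)
open import Data.Integer as ℤ using (ℤ; +_; _+_; _*_; -_; _-_; ∣_∣; _≤_)
open import Data.Fin using (Fin)
open import Data.Fin.Properties using (any?)
open import Data.Vec as V using (Vec; []; _∷_)
open import Data.Vec.Properties using (≡-dec)
open import Data.List using (List; []; _∷_)
open import Data.Product using (Σ; ∃; ∃-syntax; _×_; _,_; proj₁; proj₂)
open import Data.Sum using (_⊎_)
open import Function using (_∘_)
open import Relation.Binary.PropositionalEquality using (_≡_; _≢_)
open import Relation.Nullary using (¬_; does)
open import Relation.Binary.Construct.Closure.ReflexiveTransitive using (Star)
open import Data.Bool using (if_then_else_)

-- Lattices.  X_*(T) and X^*(T) are both identified with ℤ^n, the
-- pairing ⟨ x , α ⟩ being the standard dot product (dual bases).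

Lat : ℕ → Set
Lat n = Vec ℤ n

⟨_,_⟩ : ∀ {n} → Lat n → Lat n → ℤ
⟨ [] , [] ⟩ = + 0
⟨ x ∷ xs , y ∷ ys ⟩ = x * y + ⟨ xs , ys ⟩

_+v_ : ∀ {n} → Lat n → Lat n → Lat n
_+v_ = V.zipWith _+_

_-v_ : ∀ {n} → Lat n → Lat n → Lat n
_-v_ = V.zipWith _-_

_·v_ : ∀ {n} → ℤ → Lat n → Lat n
k ·v x = V.map (k *_) x

zeroV : ∀ {n} → Lat n
zeroV = V.replicate _ (+ 0)

lincomb : ∀ {n r} → (Fin r → ℤ) → (Fin r → Lat n) → Lat n
lincomb {r = zero} c v = zeroV
lincomb {r = suc r} c v = (c Data.Fin.zero ·v v Data.Fin.zero) +v lincomb (c ∘ Data.Fin.suc) (v ∘ Data.Fin.suc)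

-- reflect a b x = x - ⟨ x , a ⟩ b.
-- On X_*:  s_α x = reflect α α^∨ x ;  on X^*:  s_α β = reflect α^∨ α β.
reflect : ∀ {n} → Lat n → Lat n → Lat n → Lat n
reflect a b x = x -v (⟨ x , a ⟩ ·v b)

-- A reduced root datum (X^*, Φ, X_*, Φ^∨) = the root datum of a split
-- reductive group, together with a system of positive roots given by a
-- base (simple roots).  Φ⁺ = {root i}, Φ = Φ⁺ ⊔ -Φ⁺, coroot i = (root i)^∨.

record PosRootDatum : Set where
  field
    n m r   : ℕ
    root    : Fin m → Lat n          -- positive roots (in X^*)
    coroot  : Fin m → Lat n          -- their coroots (in X_*)
    root-inj : ∀ i j → root i ≡ root j → i ≡ j
    pair-two : ∀ i → ⟨ coroot i , root i ⟩ ≡ + 2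
    refl-closed : ∀ i j → ∃[ k ] ∃[ ε ] ((ε ≡ + 1 ⊎ ε ≡ - (+ 1))
                    × reflect (coroot i) (root i) (root j) ≡ ε ·v root k
                    × reflect (root i) (coroot i) (coroot j) ≡ ε ·v coroot k)
    reduced : ∀ i j → root j ≢ (+ 2) ·v root i
    simple : Fin r → Fin m
    simple-indep : ∀ (c : Fin r → ℤ) → lincomb c (root ∘ simple) ≡ zeroV → ∀ j → c j ≡ + 0
    pos-comb : ∀ i → ∃[ c ] ((∀ j → + 0 ≤ c j) × root i ≡ lincomb c (root ∘ simple))

module _ (D : PosRootDatum) where
  open PosRootDatum D

  -- Weyl group elements: words in the reflections s_α (α ∈ Φ⁺), which
  -- generate W; they are compared by their action on X_*.
  Wd : Set
  Wd = List (Fin m)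

  act : Wd → Lat n → Lat n
  act [] x = x
  act (i ∷ w) x = reflect (root i) (coroot i) (act w x)

  -- β ↦ β ∘ w  (i.e. w⁻¹ β) on X^*
  coact : Wd → Lat n → Lat n
  coact [] β = β
  coact (i ∷ w) β = coact w (reflect (coroot i) (root i) β)

  -- extended affine Weyl group: (λ , w) stands for t^λ w, x ↦ w(x) + λ
  W~ : Set
  W~ = Lat n × Wd

  _≈_ : W~ → W~ → Set
  (λ₁ , w₁) ≈ (λ₂ , w₂) = λ₁ ≡ λ₂ × (∀ x → act w₁ x ≡ act w₂ x)

  t : Lat n → W~
  t μ = μ , []

  isPos : Lat n → Data.Bool.Bool
  isPos β = does (any? (λ i → ≡-dec ℤ._≟_ (root i) β))

  -- alcPos x i = the integer k with x(A₀) ⊂ {k < ⟨ y , α_i ⟩ < k+1}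
  -- (for x = t^λ w: k = ⟨λ,α⟩ if w⁻¹α > 0, and ⟨λ,α⟩ - 1 otherwise)
  alcPos : W~ → Fin m → ℤ
  alcPos (μ , w) i = if isPos (coact w (root i)) then ⟨ μ , root i ⟩ else ⟨ μ , root i ⟩ - + 1

  sumFin : ∀ {k} → (Fin k → ℕ) → ℕ
  sumFin {zero} f = 0
  sumFin {suc k} f = f Data.Fin.zero ℕ.+ sumFin (f ∘ Data.Fin.suc)

  -- length = number of affine root hyperplanes H_{α,k} separating A₀ and x(A₀)
  len : W~ → ℕ
  len x = sumFin (λ i → ∣ alcPos x i ∣)

  -- left multiplication by the affine reflection s_{α_i,k} = t^{k α_i^∨} s_{α_i}
  affRefl : Fin m → ℤ → W~ → W~
  affRefl i k (μ , w) = (k ·v coroot i) +v reflect (root i) (coroot i) μ , i ∷ w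

  Step : W~ → W~ → Set
  Step x y = ∃[ i ] ∃[ k ] (y ≡ affRefl i k x × len x ℕ.< len y)

  _≤B_ : W~ → W~ → Set
  x ≤B y = ∃[ y' ] (Star Step x y' × y' ≈ y)

  Adm : Lat n → W~ → Set
  Adm μ x = ∃[ w ] (x ≤B t (act w μ))

  Regular : W~ → Set
  Regular x = ¬ (∃[ i ] alcPos x i ≡ + 0)

-- If t^μ ≤ t^{wρ} in the Bruhat order, either t^μ = t^{wρ} or ℓ(t^μ) < ℓ(t^{wρ}) = ℓ(t^ρ),
-- where ℓ(t^μ) = Σ_{α>0} |⟨μ, α⟩|.  The second case is impossible for regular μ, because
-- ℓ(t^ρ) is the least length of a regular translation: the reflections permute the positive
-- roots up to sign, hence preserve ℓ, and reflecting in roots α with ⟨μ, α⟩ < 0 moves μ to a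
-- dominant regular coweight μ'; then ⟨μ', α_j⟩ ≥ 1 = ⟨ρ, α_j⟩ on simple roots, so
-- ⟨μ', α⟩ ≥ ⟨ρ, α⟩ for every positive root.  The descent terminates because each such
-- reflection raises ⟨μ, δ⟩ (δ the sum of the positive roots), which is bounded by ℓ(t^μ).
-- Conversely every t^{wρ} is admissible, and regular because ρ is.

module Submission where

open import Defs
open import Data.Integer using (+_)
open import Data.Fin using (Fin)
open import Data.Product using (∃-syntax; _×_)
open import Function.Bundles using (_⇔_)
open import Relation.Binary.PropositionalEquality using (_≡_)

open import Data.Nat as ℕ using (ℕ; zero; suc)
import Data.Nat.Properties as ℕP
open import Data.Integer as ℤ using (ℤ; _+_; _*_; -_; _-_; ∣_∣; _≤_; _<_; -[1+_]; +≤+; +<+)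
import Data.Integer.Properties as ℤP
open import Data.Integer.Tactic.RingSolver using (solve-∀)
open import Algebra.Properties.Semiring.Sum ℤP.+-*-semiring using (sum; sum-cong-≗; sum-replicate-zero)
open import Algebra.Properties.CommutativeMonoid.Sum ℕP.+-0-commutativeMonoid
  using () renaming (sum to sumℕ; sum-permute to sumℕ-permute)
open import Data.Fin using (zero; suc)
open import Data.Fin.Permutation using (permutation)
open import Data.Fin.Properties using (any?)
open import Data.Vec.Properties using (≡-dec)
open import Data.Vec using ([]; _∷_)
open import Data.List using ([]; _∷_; _++_)
open import Data.Product using (_,_; proj₁; proj₂)
open import Data.Sum using (_⊎_; inj₁; inj₂)
open import Data.Bool using (true; if_then_else_)
open import Data.Empty using (⊥-elim)
open import Function using (_∘_)
open import Function.Bundles using (mk⇔; Equivalence)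
open import Relation.Nullary using (yes; no)
open import Relation.Nullary.Decidable using (dec-true)
open import Relation.Binary.PropositionalEquality using (_≢_; refl; sym; trans; cong; cong₂; subst; subst₂; module ≡-Reasoning)
open import Relation.Binary.Construct.Closure.ReflexiveTransitive using (Star; ε; _◅_)

Sign : ℤ → Set
Sign σ = σ ≡ + 1 ⊎ σ ≡ - (+ 1)

Sign-* : ∀ {a b} → Sign a → Sign b → Sign (a * b)
Sign-* (inj₁ refl) (inj₁ refl) = inj₁ refl
Sign-* (inj₁ refl) (inj₂ refl) = inj₂ refl
Sign-* (inj₂ refl) (inj₁ refl) = inj₂ refl
Sign-* (inj₂ refl) (inj₂ refl) = inj₁ refl

∣Sign*∣ : ∀ {σ} → Sign σ → ∀ a → ∣ σ * a ∣ ≡ ∣ a ∣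
∣Sign*∣ (inj₁ refl) a = cong ∣_∣ (ℤP.*-identityˡ a)
∣Sign*∣ (inj₂ refl) a = trans (cong ∣_∣ (ℤP.-1*i≡-i a)) (ℤP.∣-i∣≡∣i∣ a)

Sign-between-positives : ∀ {σ a b} → Sign σ → + 0 < a → + 0 < b → a ≡ σ * b → σ ≡ + 1
Sign-between-positives (inj₁ σ≡1) _ _ _ = σ≡1
Sign-between-positives {b = b} (inj₂ refl) 0<a 0<b a≡-b =
  ⊥-elim (ℤP.<-asym 0<a (subst (_< + 0) (sym (trans a≡-b (ℤP.-1*i≡-i b))) (ℤP.neg-mono-< 0<b)))

i≤∣i∣ : ∀ i → i ≤ + ∣ i ∣
i≤∣i∣ (+ n) = ℤP.≤-refl
i≤∣i∣ -[1+ n ] = ℤ.-≤+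

i<∣i∣ : ∀ {i} → i < + 0 → i < + ∣ i ∣
i<∣i∣ { -[1+ n ]} _ = ℤ.-<+
i<∣i∣ {+ n} (+<+ ())

i≤j+∣i-j∣ : ∀ i j → i ≤ j + + ∣ i - j ∣
i≤j+∣i-j∣ i j = subst (_≤ j + + ∣ i - j ∣) (j+[i-j]≡i i j) (ℤP.+-monoʳ-≤ j (i≤∣i∣ (i - j)))
  where
  j+[i-j]≡i : ∀ i j → j + (i - j) ≡ i
  j+[i-j]≡i = solve-∀

+-nonNeg-≡0 : ∀ {a b} → + 0 ≤ a → + 0 ≤ b → a + b ≡ + 0 → a ≡ + 0 × b ≡ + 0
+-nonNeg-≡0 {+ p} {+ q} _ _ p+q≡0 =
  cong +_ (ℕP.m+n≡0⇒m≡0 p (ℤP.+-injective p+q≡0)) , cong +_ (ℕP.m+n≡0⇒n≡0 p (ℤP.+-injective p+q≡0))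

a-h*x<a⇒0<x : ∀ a h x → + 0 < h → a - h * x < a → + 0 < x
a-h*x<a⇒0<x a h (+ suc x) _ _ = +<+ (ℕ.s≤s ℕ.z≤n)
a-h*x<a⇒0<x a h (+ zero) _ lt
  rewrite ℤP.*-zeroʳ h | ℤP.+-identityʳ a = ⊥-elim (ℤP.<-irrefl refl lt)
a-h*x<a⇒0<x a (+ suc h) -[1+ x ] _ lt = ⊥-elim (ℤP.<-irrefl refl (ℤP.≤-<-trans (ℤP.i≤i+j a _) lt))
a-h*x<a⇒0<x a (+ zero) -[1+ x ] (+<+ ()) _

a+1≤a-c*x : ∀ a c x → c < + 0 → + 0 < x → a + + 1 ≤ a - c * x
a+1≤a-c*x a -[1+ c ] (+ suc x) _ _ = ℤP.+-monoʳ-≤ a (+≤+ (ℕ.s≤s ℕ.z≤n))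
a+1≤a-c*x a -[1+ c ] (+ zero) _ (+<+ ())
a+1≤a-c*x a (+ c) x (+<+ ()) _

sum-mono-≤ : ∀ {k} {f g : Fin k → ℤ} → (∀ i → f i ≤ g i) → sum f ≤ sum g
sum-mono-≤ {zero} _ = ℤP.≤-refl
sum-mono-≤ {suc k} f≤g = ℤP.+-mono-≤ (f≤g zero) (sum-mono-≤ (f≤g ∘ suc))

sum-mono-< : ∀ {k} {f g : Fin k → ℤ} → (∀ i → f i ≤ g i) → ∀ i → f i < g i → sum f < sum g
sum-mono-< f≤g zero fi<gi = ℤP.+-mono-<-≤ fi<gi (sum-mono-≤ (f≤g ∘ suc))
sum-mono-< f≤g (suc i) fi<gi =
  ℤP.+-mono-≤-< (f≤g zero) (sum-mono-< (f≤g ∘ suc) i fi<gi)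

sum-nonNeg : ∀ {k} {c : Fin k → ℤ} → (∀ i → + 0 ≤ c i) → + 0 ≤ sum c
sum-nonNeg {zero} _ = ℤP.≤-refl
sum-nonNeg {suc k} 0≤c = ℤP.+-mono-≤ (0≤c zero) (sum-nonNeg (0≤c ∘ suc))

sum-nonNeg-≡0 : ∀ {k} {c : Fin k → ℤ} → (∀ i → + 0 ≤ c i) → sum c ≡ + 0 → ∀ i → c i ≡ + 0
sum-nonNeg-≡0 {suc k} 0≤c Σc≡0 i
  with +-nonNeg-≡0 (0≤c zero) (sum-nonNeg (0≤c ∘ suc)) Σc≡0
sum-nonNeg-≡0 {suc k} 0≤c Σc≡0 zero | c₀≡0 , _ = c₀≡0
sum-nonNeg-≡0 {suc k} 0≤c Σc≡0 (suc i) | _ , Σc'≡0 = sum-nonNeg-≡0 (0≤c ∘ suc) Σc'≡0 i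

⟨⟩-comm : ∀ {n} (x y : Lat n) → ⟨ x , y ⟩ ≡ ⟨ y , x ⟩
⟨⟩-comm [] [] = refl
⟨⟩-comm (a ∷ x) (b ∷ y) = cong₂ _+_ (ℤP.*-comm a b) (⟨⟩-comm x y)

⟨⟩-zeroʳ : ∀ {n} (x : Lat n) → ⟨ x , zeroV ⟩ ≡ + 0
⟨⟩-zeroʳ [] = refl
⟨⟩-zeroʳ (a ∷ x) rewrite ⟨⟩-zeroʳ x | ℤP.*-zeroʳ a = refl

⟨⟩-+vʳ : ∀ {n} (x u v : Lat n) → ⟨ x , u +v v ⟩ ≡ ⟨ x , u ⟩ + ⟨ x , v ⟩
⟨⟩-+vʳ [] [] [] = refl
⟨⟩-+vʳ (a ∷ x) (b ∷ u) (c ∷ v) rewrite ⟨⟩-+vʳ x u v = distrib a b c ⟨ x , u ⟩ ⟨ x , v ⟩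
  where
  distrib : ∀ a b c p q → a * (b + c) + (p + q) ≡ (a * b + p) + (a * c + q)
  distrib = solve-∀

⟨⟩-·vʳ : ∀ {n} (x : Lat n) c y → ⟨ x , c ·v y ⟩ ≡ c * ⟨ x , y ⟩
⟨⟩-·vʳ [] c [] = sym (ℤP.*-zeroʳ c)
⟨⟩-·vʳ (a ∷ x) c (b ∷ y) rewrite ⟨⟩-·vʳ x c y = distrib a b c ⟨ x , y ⟩
  where
  distrib : ∀ a b c p → a * (c * b) + c * p ≡ c * (a * b + p)
  distrib = solve-∀

⟨⟩-sub-·vʳ : ∀ {n} (y x b : Lat n) c → ⟨ y , x -v (c ·v b) ⟩ ≡ ⟨ y , x ⟩ - c * ⟨ y , b ⟩
⟨⟩-sub-·vʳ [] [] [] c = sym (cong (λ z → + 0 - z) (ℤP.*-zeroʳ c))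
⟨⟩-sub-·vʳ (a ∷ y) (u ∷ x) (v ∷ b) c rewrite ⟨⟩-sub-·vʳ y x b c = distrib a u v c ⟨ y , x ⟩ ⟨ y , b ⟩
  where
  distrib : ∀ a u v c p q → a * (u - c * v) + (p - c * q) ≡ (a * u + p) - c * (a * v + q)
  distrib = solve-∀

⟨⟩-lincombʳ : ∀ {n r} (x : Lat n) (c : Fin r → ℤ) (v : Fin r → Lat n)
  → ⟨ x , lincomb c v ⟩ ≡ sum (λ j → c j * ⟨ x , v j ⟩)
⟨⟩-lincombʳ {r = zero} x c v = ⟨⟩-zeroʳ x
⟨⟩-lincombʳ {r = suc r} x c v = trans (⟨⟩-+vʳ x _ _)
  (cong₂ _+_ (⟨⟩-·vʳ x (c zero) _) (⟨⟩-lincombʳ x (c ∘ suc) (v ∘ suc)))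

⟨⟩-injectiveʳ : ∀ {n} {a b : Lat n} → (∀ x → ⟨ x , a ⟩ ≡ ⟨ x , b ⟩) → a ≡ b
⟨⟩-injectiveʳ {a = []} {[]} _ = refl
⟨⟩-injectiveʳ {a = a ∷ as} {b ∷ bs} same = cong₂ _∷_ head-equal (⟨⟩-injectiveʳ tail-equal)
  where
  ⟨0,_⟩ : ∀ {n} (v : Lat n) → ⟨ zeroV , v ⟩ ≡ + 0
  ⟨0, v ⟩ = trans (⟨⟩-comm zeroV v) (⟨⟩-zeroʳ v)
  head-equal : a ≡ b
  head-equal with same (+ 1 ∷ zeroV)
  ... | e rewrite ⟨0, as ⟩ | ⟨0, bs ⟩ | ℤP.*-identityˡ a | ℤP.*-identityˡ b
        | ℤP.+-identityʳ a | ℤP.+-identityʳ b = e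
  tail-equal : ∀ x → ⟨ x , as ⟩ ≡ ⟨ x , bs ⟩
  tail-equal x with same (+ 0 ∷ x)
  ... | e rewrite ℤP.*-zeroˡ a | ℤP.*-zeroˡ b
        | ℤP.+-identityˡ ⟨ x , as ⟩ | ℤP.+-identityˡ ⟨ x , bs ⟩ = e

⟨⟩-reflectʳ : ∀ {n} (a b x y : Lat n) → ⟨ y , reflect a b x ⟩ ≡ ⟨ y , x ⟩ - ⟨ x , a ⟩ * ⟨ y , b ⟩
⟨⟩-reflectʳ a b x y = ⟨⟩-sub-·vʳ y x b ⟨ x , a ⟩

⟨⟩-reflectˡ : ∀ {n} (a b x y : Lat n) → ⟨ reflect a b x , y ⟩ ≡ ⟨ x , y ⟩ - ⟨ x , a ⟩ * ⟨ b , y ⟩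
⟨⟩-reflectˡ a b x y = trans (⟨⟩-comm _ y) (trans (⟨⟩-reflectʳ a b x y)
  (cong₂ (λ u v → u - ⟨ x , a ⟩ * v) (⟨⟩-comm y x) (⟨⟩-comm y b)))

reflect-adjoint : ∀ {n} (a b x y : Lat n) → ⟨ reflect a b x , y ⟩ ≡ ⟨ x , reflect b a y ⟩
reflect-adjoint a b x y = begin
  ⟨ reflect a b x , y ⟩                ≡⟨ ⟨⟩-reflectˡ a b x y ⟩
  ⟨ x , y ⟩ - ⟨ x , a ⟩ * ⟨ b , y ⟩    ≡⟨ cong (λ u → ⟨ x , y ⟩ - u) (ℤP.*-comm ⟨ x , a ⟩ _) ⟩
  ⟨ x , y ⟩ - ⟨ b , y ⟩ * ⟨ x , a ⟩    ≡⟨ cong (λ u → ⟨ x , y ⟩ - u * ⟨ x , a ⟩) (⟨⟩-comm b y) ⟩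
  ⟨ x , y ⟩ - ⟨ y , b ⟩ * ⟨ x , a ⟩    ≡⟨ ⟨⟩-reflectʳ b a y x ⟨
  ⟨ x , reflect b a y ⟩                ∎
  where open ≡-Reasoning

reflect-involutive : ∀ {n} (a b : Lat n) → ⟨ b , a ⟩ ≡ + 2 → ∀ x → reflect a b (reflect a b x) ≡ x
reflect-involutive a b ⟨b,a⟩≡2 x = ⟨⟩-injectiveʳ λ y → begin
  ⟨ y , reflect a b (reflect a b x) ⟩                                        ≡⟨ ⟨⟩-reflectʳ a b _ y ⟩
  ⟨ y , reflect a b x ⟩ - ⟨ reflect a b x , a ⟩ * ⟨ y , b ⟩                ≡⟨ cong₂ (λ u v → u - v * ⟨ y , b ⟩)
                                                                                (⟨⟩-reflectʳ a b x y) ⟨rx,a⟩ ⟩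
  (⟨ y , x ⟩ - ⟨ x , a ⟩ * ⟨ y , b ⟩) - (⟨ x , a ⟩ - ⟨ x , a ⟩ * + 2) * ⟨ y , b ⟩  ≡⟨ cancel ⟨ y , x ⟩ ⟨ x , a ⟩ ⟨ y , b ⟩ ⟩
  ⟨ y , x ⟩                                                                  ∎
  where
  open ≡-Reasoning
  ⟨rx,a⟩ : ⟨ reflect a b x , a ⟩ ≡ ⟨ x , a ⟩ - ⟨ x , a ⟩ * + 2
  ⟨rx,a⟩ = trans (⟨⟩-reflectˡ a b x a) (cong (λ k → ⟨ x , a ⟩ - ⟨ x , a ⟩ * k) ⟨b,a⟩≡2)
  cancel : ∀ p q r → (p - q * r) - (q - q * + 2) * r ≡ p
  cancel = solve-∀

module _ (D : PosRootDatum) where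
  open PosRootDatum D

  sumFin-cong : ∀ {k} {f g : Fin k → ℕ} → (∀ i → f i ≡ g i) → sumFin D f ≡ sumFin D g
  sumFin-cong {zero} _ = refl
  sumFin-cong {suc k} f≗g = cong₂ ℕ._+_ (f≗g zero) (sumFin-cong (f≗g ∘ suc))

  sumFin≡sumℕ : ∀ {k} (f : Fin k → ℕ) → sumFin D f ≡ sumℕ f
  sumFin≡sumℕ {zero} f = refl
  sumFin≡sumℕ {suc k} f = cong (f zero ℕ.+_) (sumFin≡sumℕ (f ∘ suc))

  sumFin-involution : ∀ {k} (τ : Fin k → Fin k) → (∀ i → τ (τ i) ≡ i) → ∀ f → sumFin D (f ∘ τ) ≡ sumFin D f
  sumFin-involution τ τ-involutive f = begin
    sumFin D (f ∘ τ)  ≡⟨ sumFin≡sumℕ (f ∘ τ) ⟩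
    sumℕ (f ∘ τ)      ≡⟨ sumℕ-permute f (permutation τ τ τ-involutive τ-involutive) ⟨
    sumℕ f            ≡⟨ sumFin≡sumℕ f ⟨
    sumFin D f        ∎
    where open ≡-Reasoning

  +-sumFin : ∀ {k} (f : Fin k → ℕ) → + sumFin D f ≡ sum (λ i → + f i)
  +-sumFin {zero} f = refl
  +-sumFin {suc k} f = cong (λ z → + f zero + z) (+-sumFin (f ∘ suc))

  s : Fin m → Lat n → Lat n
  s i = reflect (root i) (coroot i)

  s-involutive : ∀ i x → s i (s i x) ≡ x
  s-involutive i = reflect-involutive (root i) (coroot i) (pair-two i)

  ⟨sᵢx,αᵢ⟩ : ∀ i x → ⟨ s i x , root i ⟩ ≡ - ⟨ x , root i ⟩
  ⟨sᵢx,αᵢ⟩ i x = trans (⟨⟩-reflectˡ (root i) (coroot i) x (root i))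
    (trans (cong (λ k → ⟨ x , root i ⟩ - ⟨ x , root i ⟩ * k) (pair-two i)) (p-p*2≡-p ⟨ x , root i ⟩))
    where
    p-p*2≡-p : ∀ p → p - p * + 2 ≡ - p
    p-p*2≡-p = solve-∀

  act-++ : ∀ u v x → act D (u ++ v) x ≡ act D u (act D v x)
  act-++ [] v x = refl
  act-++ (i ∷ u) v x = cong (s i) (act-++ u v x)

  act-coact : ∀ w x y → ⟨ act D w x , y ⟩ ≡ ⟨ x , coact D w y ⟩
  act-coact [] x y = refl
  act-coact (i ∷ w) x y =
    trans (reflect-adjoint (root i) (coroot i) (act D w x) y) (act-coact w x _)

  coact-cong : ∀ {u v} → (∀ x → act D u x ≡ act D v x) → ∀ y → coact D u y ≡ coact D v y
  coact-cong {u} {v} act-u≗act-v y = ⟨⟩-injectiveʳ λ x → begin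
    ⟨ x , coact D u y ⟩  ≡⟨ act-coact u x y ⟨
    ⟨ act D u x , y ⟩    ≡⟨ cong (λ z → ⟨ z , y ⟩) (act-u≗act-v x) ⟩
    ⟨ act D v x , y ⟩    ≡⟨ act-coact v x y ⟩
    ⟨ x , coact D v y ⟩  ∎
    where open ≡-Reasoning

  -- The reflection s_{α_i} maps the root α_j to σ i j · α_{π i j}.
  π : Fin m → Fin m → Fin m
  π i j = proj₁ (refl-closed i j)

  σ : Fin m → Fin m → ℤ
  σ i j = proj₁ (proj₂ (refl-closed i j))

  σ-Sign : ∀ i j → Sign (σ i j)
  σ-Sign i j = proj₁ (proj₂ (proj₂ (refl-closed i j)))

  ⟨s,root⟩ : ∀ i j x → ⟨ s i x , root j ⟩ ≡ σ i j * ⟨ x , root (π i j) ⟩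
  ⟨s,root⟩ i j x = begin
    ⟨ s i x , root j ⟩                           ≡⟨ reflect-adjoint (root i) (coroot i) x (root j) ⟩
    ⟨ x , reflect (coroot i) (root i) (root j) ⟩  ≡⟨ cong (λ y → ⟨ x , y ⟩) (proj₁ (proj₂ (proj₂ (proj₂ (refl-closed i j))))) ⟩
    ⟨ x , σ i j ·v root (π i j) ⟩                 ≡⟨ ⟨⟩-·vʳ x (σ i j) (root (π i j)) ⟩
    σ i j * ⟨ x , root (π i j) ⟩                  ∎
    where open ≡-Reasoning

  ∣⟨s,root⟩∣ : ∀ i j x → ∣ ⟨ s i x , root j ⟩ ∣ ≡ ∣ ⟨ x , root (π i j) ⟩ ∣
  ∣⟨s,root⟩∣ i j x = trans (cong ∣_∣ (⟨s,root⟩ i j x)) (∣Sign*∣ (σ-Sign i j) _)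

  RegularCoweight : Lat n → Set
  RegularCoweight p = ∀ i → ⟨ p , root i ⟩ ≢ + 0

  Dominant : Lat n → Set
  Dominant p = ∀ i → + 0 ≤ ⟨ p , root i ⟩

  s-regular : ∀ i p → RegularCoweight p → RegularCoweight (s i p)
  s-regular i p p-reg j ⟨sp,α⟩≡0 =
    p-reg (π i j) (ℤP.∣i∣≡0⇒i≡0 (trans (sym (∣⟨s,root⟩∣ i j p)) (cong ∣_∣ ⟨sp,α⟩≡0)))

  act-regular : ∀ w p → RegularCoweight p → RegularCoweight (act D w p)
  act-regular [] p p-reg = p-reg
  act-regular (i ∷ w) p p-reg = s-regular i (act D w p) (act-regular w p p-reg)

  ⟨⟩-root-expansion : ∀ i x → ⟨ x , root i ⟩ ≡ sum (λ j → proj₁ (pos-comb i) j * ⟨ x , root (simple j) ⟩)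
  ⟨⟩-root-expansion i x =
    trans (cong (λ y → ⟨ x , y ⟩) (proj₂ (proj₂ (pos-comb i)))) (⟨⟩-lincombʳ x _ (root ∘ simple))

  ℓ : Lat n → ℕ
  ℓ p = sumFin D (λ i → ∣ ⟨ p , root i ⟩ ∣)

  δ : Lat n
  δ = lincomb (λ _ → + 1) root

  ⟨⟩-δ : ∀ p → ⟨ p , δ ⟩ ≡ sum (λ i → ⟨ p , root i ⟩)
  ⟨⟩-δ p = trans (⟨⟩-lincombʳ p (λ _ → + 1) root) (sum-cong-≗ (λ i → ℤP.*-identityˡ ⟨ p , root i ⟩))

  ⟨⟩-δ≤ℓ : ∀ p → ⟨ p , δ ⟩ ≤ + ℓ p
  ⟨⟩-δ≤ℓ p = subst₂ _≤_ (sym (⟨⟩-δ p)) (sym (+-sumFin (λ i → ∣ ⟨ p , root i ⟩ ∣))) (sum-mono-≤ (λ i → i≤∣i∣ ⟨ p , root i ⟩))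

  ⟨⟩-δ<ℓ : ∀ p i → ⟨ p , root i ⟩ < + 0 → ⟨ p , δ ⟩ < + ℓ p
  ⟨⟩-δ<ℓ p i negative =
    subst₂ _<_ (sym (⟨⟩-δ p)) (sym (+-sumFin (λ i → ∣ ⟨ p , root i ⟩ ∣)))
      (sum-mono-< (λ i → i≤∣i∣ ⟨ p , root i ⟩) i (i<∣i∣ negative))

  dominant⇒⟨⟩-δ≡ℓ : ∀ p → Dominant p → ⟨ p , δ ⟩ ≡ + ℓ p
  dominant⇒⟨⟩-δ≡ℓ p p-dominant = trans (⟨⟩-δ p)
    (trans (sum-cong-≗ (λ i → sym (ℤP.0≤i⇒+∣i∣≡i (p-dominant i)))) (sym (+-sumFin (λ i → ∣ ⟨ p , root i ⟩ ∣))))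

  ⟨s,δ⟩ : ∀ i p → ⟨ s i p , δ ⟩ ≡ ⟨ p , δ ⟩ - ⟨ p , root i ⟩ * ⟨ coroot i , δ ⟩
  ⟨s,δ⟩ i p = ⟨⟩-reflectˡ (root i) (coroot i) p δ

  isPos-root : ∀ i → isPos D (root i) ≡ true
  isPos-root i = dec-true (any? (λ j → ≡-dec ℤ._≟_ (root j) (root i))) (i , refl)

  alcPos-t : ∀ μ i → alcPos D (t D μ) i ≡ ⟨ μ , root i ⟩
  alcPos-t μ i rewrite isPos-root i = refl

  len-t : ∀ μ → len D (t D μ) ≡ ℓ μ
  len-t μ = sumFin-cong (λ i → cong ∣_∣ (alcPos-t μ i))

  len-cong : ∀ x y → _≈_ D x y → len D x ≡ len D y
  len-cong (μ , u) (.μ , v) (refl , act-u≗act-v) = sumFin-cong (λ i → cong ∣_∣ (alcPos-equal i))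
    where
    alcPos-equal : ∀ i → alcPos D (μ , u) i ≡ alcPos D (μ , v) i
    alcPos-equal i = cong (λ β → if isPos D β then ⟨ μ , root i ⟩ else ⟨ μ , root i ⟩ - + 1)
                          (coact-cong {u} {v} act-u≗act-v (root i))

  Star-len-mono : ∀ {x y} → Star (Step D) x y → len D x ℕ.≤ len D y
  Star-len-mono ε = ℕP.≤-refl
  Star-len-mono ((_ , _ , _ , x<x') ◅ x'≤y) = ℕP.≤-trans (ℕP.<⇒≤ x<x') (Star-len-mono x'≤y)

  ≤B⇒≈⊎len< : ∀ x y → _≤B_ D x y → _≈_ D x y ⊎ len D x ℕ.< len D y
  ≤B⇒≈⊎len< x y (_ , ε , x≈y) = inj₁ x≈y
  ≤B⇒≈⊎len< x y (y' , (_ , _ , _ , x<x') ◅ x'≤y' , y'≈y) =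
    inj₂ (subst (len D x ℕ.<_) (len-cong y' y y'≈y) (ℕP.<-≤-trans x<x' (Star-len-mono x'≤y')))

  Regular-t⇔ : ∀ μ → Regular D (t D μ) ⇔ RegularCoweight μ
  Regular-t⇔ μ = mk⇔
    (λ reg i ⟨μ,α⟩≡0 → reg (i , trans (alcPos-t μ i) ⟨μ,α⟩≡0))
    (λ { μ-reg (i , alcPos≡0) → μ-reg i (trans (sym (alcPos-t μ i)) alcPos≡0) })

module _ (D : PosRootDatum) (ρ : Lat (PosRootDatum.n D))
         (ρ-simple : ∀ j → ⟨ ρ , PosRootDatum.root D (PosRootDatum.simple D j) ⟩ ≡ + 1) where
  open PosRootDatum D

  ρ-positive : ∀ i → + 0 < ⟨ ρ , root i ⟩
  ρ-positive i = subst (+ 0 <_) (sym ⟨ρ,α⟩≡Σc) (ℤP.≤∧≢⇒< (sum-nonNeg c≥0) (Σc≢0 ∘ sym))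
    where
    c = proj₁ (pos-comb i)
    c≥0 = proj₁ (proj₂ (pos-comb i))
    ⟨ρ,α⟩≡Σc : ⟨ ρ , root i ⟩ ≡ sum c
    ⟨ρ,α⟩≡Σc = trans (⟨⟩-root-expansion D i ρ)
      (sum-cong-≗ (λ j → trans (cong (c j *_) (ρ-simple j)) (ℤP.*-identityʳ (c j))))
    -- Otherwise α_i = 0, contradicting ⟨α_i^∨, α_i⟩ = 2.
    Σc≢0 : sum c ≢ + 0
    Σc≢0 Σc≡0 = 2≢0 (begin
      + 2                                                        ≡⟨ pair-two i ⟨
      ⟨ coroot i , root i ⟩                                      ≡⟨ ⟨⟩-root-expansion D i (coroot i) ⟩
      sum (λ j → c j * ⟨ coroot i , root (simple j) ⟩)           ≡⟨ sum-cong-≗ vanishing-terms ⟩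
      sum (λ (_ : Fin r) → + 0)                                  ≡⟨ sum-replicate-zero r ⟩
      + 0                                                        ∎)
      where
      open ≡-Reasoning
      vanishing-terms : ∀ j → c j * ⟨ coroot i , root (simple j) ⟩ ≡ + 0
      vanishing-terms j = trans (cong (_* ⟨ coroot i , root (simple j) ⟩) (sum-nonNeg-≡0 c≥0 Σc≡0 j))
                                  (ℤP.*-zeroˡ ⟨ coroot i , root (simple j) ⟩)
      2≢0 : + 2 ≢ + 0
      2≢0 ()

  ρ-dominant : Dominant D ρ
  ρ-dominant i = ℤP.<⇒≤ (ρ-positive i)

  ρ-regular : RegularCoweight D ρ
  ρ-regular i ⟨ρ,α⟩≡0 = ℤP.<⇒≢ (ρ-positive i) (sym ⟨ρ,α⟩≡0)

  -- s_i² = 1 gives α_j = ± α_{π i (π i j)}, and positivity of ρ on positive roots fixes the sign.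
  π-involutive : ∀ i j → π D i (π D i j) ≡ j
  π-involutive i j = sym (root-inj j l (⟨⟩-injectiveʳ same-pairing))
    where
    k = π D i j
    l = π D i k
    sign = σ D i j * σ D i k
    ⟨x,αⱼ⟩ : ∀ x → ⟨ x , root j ⟩ ≡ sign * ⟨ x , root l ⟩
    ⟨x,αⱼ⟩ x = begin
      ⟨ x , root j ⟩                          ≡⟨ cong (λ y → ⟨ y , root j ⟩) (s-involutive D i x) ⟨
      ⟨ s D i (s D i x) , root j ⟩            ≡⟨ ⟨s,root⟩ D i j (s D i x) ⟩
      σ D i j * ⟨ s D i x , root k ⟩          ≡⟨ cong (σ D i j *_) (⟨s,root⟩ D i k x) ⟩
      σ D i j * (σ D i k * ⟨ x , root l ⟩)    ≡⟨ ℤP.*-assoc (σ D i j) (σ D i k) _ ⟨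
      sign * ⟨ x , root l ⟩                   ∎
      where open ≡-Reasoning
    sign≡1 : sign ≡ + 1
    sign≡1 = Sign-between-positives (Sign-* (σ-Sign D i j) (σ-Sign D i k)) (ρ-positive j) (ρ-positive l) (⟨x,αⱼ⟩ ρ)
    same-pairing : ∀ x → ⟨ x , root j ⟩ ≡ ⟨ x , root l ⟩
    same-pairing x = trans (⟨x,αⱼ⟩ x) (trans (cong (_* ⟨ x , root l ⟩) sign≡1) (ℤP.*-identityˡ _))

  ℓ-s : ∀ i p → ℓ D (s D i p) ≡ ℓ D p
  ℓ-s i p = trans (sumFin-cong D (λ j → ∣⟨s,root⟩∣ D i j p))
                  (sumFin-involution D (π D i) (π-involutive i) (λ k → ∣ ⟨ p , root k ⟩ ∣))

  ℓ-act : ∀ w p → ℓ D (act D w p) ≡ ℓ D p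
  ℓ-act [] p = refl
  ℓ-act (i ∷ w) p = trans (ℓ-s i (act D w p)) (ℓ-act w p)

  -- s_i ρ has the length of ρ, but ⟨s_i ρ, α_i⟩ < 0 makes ⟨s_i ρ, δ⟩ fall short of it.
  ⟨coroot,δ⟩-positive : ∀ i → + 0 < ⟨ coroot i , δ D ⟩
  ⟨coroot,δ⟩-positive i = a-h*x<a⇒0<x ⟨ ρ , δ D ⟩ ⟨ ρ , root i ⟩ _ (ρ-positive i) (begin-strict
    ⟨ ρ , δ D ⟩ - ⟨ ρ , root i ⟩ * ⟨ coroot i , δ D ⟩  ≡⟨ ⟨s,δ⟩ D i ρ ⟨
    ⟨ s D i ρ , δ D ⟩                                   <⟨ ⟨⟩-δ<ℓ D (s D i ρ) i ⟨sρ,α⟩<0 ⟩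
    + ℓ D (s D i ρ)                                     ≡⟨ cong +_ (ℓ-s i ρ) ⟩
    + ℓ D ρ                                             ≡⟨ dominant⇒⟨⟩-δ≡ℓ D ρ ρ-dominant ⟨
    ⟨ ρ , δ D ⟩                                         ∎)
    where
    open ℤP.≤-Reasoning
    ⟨sρ,α⟩<0 : ⟨ s D i ρ , root i ⟩ < + 0
    ⟨sρ,α⟩<0 = subst (_< + 0) (sym (⟨sᵢx,αᵢ⟩ D i ρ)) (ℤP.neg-mono-< (ρ-positive i))

  ⟨s,δ⟩-increases : ∀ i p → ⟨ p , root i ⟩ < + 0 → ⟨ p , δ D ⟩ + + 1 ≤ ⟨ s D i p , δ D ⟩
  ⟨s,δ⟩-increases i p negative = subst (⟨ p , δ D ⟩ + + 1 ≤_) (sym (⟨s,δ⟩ D i p))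
    (a+1≤a-c*x ⟨ p , δ D ⟩ _ _ negative (⟨coroot,δ⟩-positive i))

  ℓ-bound-s : ∀ i p k → ⟨ p , root i ⟩ < + 0
    → + ℓ D p ≤ ⟨ p , δ D ⟩ + + suc k → + ℓ D (s D i p) ≤ ⟨ s D i p , δ D ⟩ + + k
  ℓ-bound-s i p k negative ℓ≤ = begin
    + ℓ D (s D i p)                 ≡⟨ cong +_ (ℓ-s i p) ⟩
    + ℓ D p                         ≤⟨ ℓ≤ ⟩
    ⟨ p , δ D ⟩ + (+ 1 + + k)       ≡⟨ ℤP.+-assoc ⟨ p , δ D ⟩ (+ 1) (+ k) ⟨
    (⟨ p , δ D ⟩ + + 1) + + k       ≤⟨ ℤP.+-monoˡ-≤ (+ k) (⟨s,δ⟩-increases i p negative) ⟩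
    ⟨ s D i p , δ D ⟩ + + k         ∎
    where open ℤP.≤-Reasoning

  dominant-conjugate : ∀ p → ∃[ w ] Dominant D (act D w p)
  dominant-conjugate p = descend _ p (i≤j+∣i-j∣ (+ ℓ D p) ⟨ p , δ D ⟩)
    where
    conjugate-s : ∀ i p → ∃[ w ] Dominant D (act D w (s D i p)) → ∃[ w ] Dominant D (act D w p)
    conjugate-s i p (w , dominant) = w ++ i ∷ [] , subst (Dominant D) (sym (act-++ D w (i ∷ []) p)) dominant
    descend : ∀ k p → + ℓ D p ≤ ⟨ p , δ D ⟩ + + k → ∃[ w ] Dominant D (act D w p)
    descend k p ℓ≤ with any? (λ i → ⟨ p , root i ⟩ ℤP.<? + 0)
    ... | no no-negative = [] , λ i → ℤP.≮⇒≥ (λ negative → no-negative (i , negative))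
    descend zero p ℓ≤ | yes (i , negative) =
      ⊥-elim (ℤP.<⇒≱ (⟨⟩-δ<ℓ D p i negative) (subst (+ ℓ D p ≤_) (ℤP.+-identityʳ _) ℓ≤))
    descend (suc k) p ℓ≤ | yes (i , negative) =
      conjugate-s i p (descend k (s D i p) (ℓ-bound-s i p k negative ℓ≤))

  ρ≤dominant-regular : ∀ q → Dominant D q → RegularCoweight D q → ∀ i → ⟨ ρ , root i ⟩ ≤ ⟨ q , root i ⟩
  ρ≤dominant-regular q q-dominant q-regular i =
    subst₂ _≤_ (sym (⟨⟩-root-expansion D i ρ)) (sym (⟨⟩-root-expansion D i q)) (sum-mono-≤ termwise)
    where
    c = proj₁ (pos-comb i)
    termwise : ∀ j → c j * ⟨ ρ , root (simple j) ⟩ ≤ c j * ⟨ q , root (simple j) ⟩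
    termwise j rewrite ρ-simple j =
      ℤP.*-monoˡ-≤-nonNeg (c j) {{ℤ.nonNegative (proj₁ (proj₂ (pos-comb i)) j)}}
        (ℤP.i<j⇒suc[i]≤j (ℤP.≤∧≢⇒< (q-dominant (simple j)) (q-regular (simple j) ∘ sym)))

  ℓ-minimal : ∀ p → RegularCoweight D p → ℓ D ρ ℕ.≤ ℓ D p
  ℓ-minimal p p-regular = ℤP.drop‿+≤+ (begin
    + ℓ D ρ                      ≡⟨ dominant⇒⟨⟩-δ≡ℓ D ρ ρ-dominant ⟨
    ⟨ ρ , δ D ⟩                  ≤⟨ subst₂ _≤_ (sym (⟨⟩-δ D ρ)) (sym (⟨⟩-δ D q))
                                      (sum-mono-≤ (ρ≤dominant-regular q q-dominant (act-regular D w p p-regular))) ⟩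
    ⟨ q , δ D ⟩                  ≤⟨ ⟨⟩-δ≤ℓ D q ⟩
    + ℓ D q                      ≡⟨ cong +_ (ℓ-act w p) ⟩
    + ℓ D p                      ∎)
    where
    open ℤP.≤-Reasoning
    w = proj₁ (dominant-conjugate p)
    q = act D w p
    q-dominant = proj₂ (dominant-conjugate p)

lemma8p8 : (D : PosRootDatum) (ρ : Lat (PosRootDatum.n D))
    → (∀ j → ⟨ ρ , PosRootDatum.root D (PosRootDatum.simple D j) ⟩ ≡ + 1)
    → (μ : Lat (PosRootDatum.n D))
    → (Adm D ρ (t D μ) × Regular D (t D μ)) ⇔ (∃[ w ] μ ≡ act D w ρ)
lemma8p8 D ρ ρ-simple μ = mk⇔ to from
  where
  to : Adm D ρ (t D μ) × Regular D (t D μ) → ∃[ w ] μ ≡ act D w ρ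
  to ((w , μ≤wρ) , μ-regular) with ≤B⇒≈⊎len< D (t D μ) (t D (act D w ρ)) μ≤wρ
  ... | inj₁ (μ≡wρ , _) = w , μ≡wρ
  ... | inj₂ len<len = ⊥-elim (ℕP.<⇒≱ ℓμ<ℓρ (ℓ-minimal D ρ ρ-simple μ (Equivalence.to (Regular-t⇔ D μ) μ-regular)))
    where
    ℓμ<ℓρ : ℓ D μ ℕ.< ℓ D ρ
    ℓμ<ℓρ = subst₂ ℕ._<_ (len-t D μ) (trans (len-t D (act D w ρ)) (ℓ-act D ρ ρ-simple w ρ)) len<len
  from : ∃[ w ] μ ≡ act D w ρ → Adm D ρ (t D μ) × Regular D (t D μ)
  from (w , refl) = (w , t D μ , ε , refl , λ _ → refl)
                  , Equivalence.from (Regular-t⇔ D μ) (act-regular D w ρ (ρ-regular D ρ ρ-simple))
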